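{- Let $Q$ be a continuous quantale, $(X,d)$ a $Q$-metric space and $A\subseteq X$. Then the closure of $A$ in the topological space $(X,\tau_d)$ is $\{y\in X\mid \forall\delta\ll I.\ \exists x\in A.\ \delta\ll d(y,x)\}$.
   Context: A quantale is a complete lattice $(Q,\sqsubseteq)$ with a monoid structure $(\otimes,I)$ such that $\otimes$ distributes over arbitrary joins on both sides. $x\ll y$ (way-below) means: for every directed $D\subseteq Q$ with $y\sqsubseteq\bigsqcup D$ there is $d\in D$ with $x\sqsubseteq d$. $Q$ is continuous if $x=\bigsqcup\{z\mid z\ll x\}$ for all $x$. A $Q$-metric space is a pair $(X,d)$ with $d:X\times X\to Q$ satisfying $d(x,y)\otimes d(y,z)\sqsubseteq d(x,z)$ and $I\sqsubseteq d(x,x)$. For $x\in X$ and $\delta\ll I$, the open ball is $B(x,\delta)=\{y\in X\mid \delta\ll d(x,y)\}$, and $\tau_d$ is the topology on $X$ generated by all open balls. -}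

module Defs where

import Level
open import Level using (0ℓ)
open import Data.Unit using (⊤)
open import Data.Product using (Σ; ∃; _×_; _,_)
open import Relation.Unary using (Pred; _⊆_; _≐_; ∁)
open import Relation.Binary.PropositionalEquality using (_≡_)

record Quantale : Set₁ where
  infix 4 _⊑_
  infixl 7 _⊗_
  field
    Carrier : Set
    _⊑_ : Carrier → Carrier → Set
    ⊑-refl : ∀ {x} → x ⊑ x
    ⊑-trans : ∀ {x y z} → x ⊑ y → y ⊑ z → x ⊑ z
    ⊑-antisym : ∀ {x y} → x ⊑ y → y ⊑ x → x ≡ y
    ⨆ : Pred Carrier 0ℓ → Carrier
    ⨆-upper : ∀ (S : Pred Carrier 0ℓ) {s} → S s → s ⊑ ⨆ S
    ⨆-least : ∀ (S : Pred Carrier 0ℓ) {u} → (∀ {s} → S s → s ⊑ u) → ⨆ S ⊑ u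
    _⊗_ : Carrier → Carrier → Carrier
    I : Carrier
    ⊗-assoc : ∀ x y z → (x ⊗ y) ⊗ z ≡ x ⊗ (y ⊗ z)
    ⊗-identityˡ : ∀ x → I ⊗ x ≡ x
    ⊗-identityʳ : ∀ x → x ⊗ I ≡ x
    ⊗-distribˡ-⨆ : ∀ a (S : Pred Carrier 0ℓ) →
      a ⊗ ⨆ S ≡ ⨆ (λ q → Σ Carrier (λ s → S s × q ≡ a ⊗ s))
    ⊗-distribʳ-⨆ : ∀ a (S : Pred Carrier 0ℓ) →
      ⨆ S ⊗ a ≡ ⨆ (λ q → Σ Carrier (λ s → S s × q ≡ s ⊗ a))

  Directed : Pred Carrier 0ℓ → Set
  Directed D = (∃ λ d → D d)
             × (∀ {a b} → D a → D b → ∃ λ c → D c × a ⊑ c × b ⊑ c)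

  infix 4 _≪_
  _≪_ : Carrier → Carrier → Set₁
  x ≪ y = ∀ (D : Pred Carrier 0ℓ) → Directed D → y ⊑ ⨆ D → ∃ λ d → D d × x ⊑ d

record IsContinuous (Q : Quantale) : Set₁ where
  open Quantale Q
  field
    -- Since _≪_ quantifies over all subsets it is
    -- Set₁-valued, so we say: there is a subset W (a Set-valued predicate)
    -- with the same elements as { z | z ≪ x }, and x = ⨆ W.
    approx : ∀ x → Σ (Pred Carrier 0ℓ) (λ W → (∀ z → W z → z ≪ x)
                                           × (∀ z → z ≪ x → W z)
                                           × x ≡ ⨆ W)

record QMetricSpace (Q : Quantale) : Set₁ where
  open Quantale Q
  field
    X : Set
    d : X → X → Carrier
    d-trans : ∀ x y z → d x y ⊗ d y z ⊑ d x z
    d-refl : ∀ x → I ⊑ d x x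

  B : X → Carrier → Pred X (Level.suc 0ℓ)
  B x δ y = δ ≪ d x y

  data IsOpen : Pred X (Level.suc 0ℓ) → Set₂ where
    ball  : ∀ x δ → δ ≪ I → IsOpen (B x δ)
    whole : IsOpen (λ _ → Level.Lift _ ⊤)
    inter : ∀ {U V} → IsOpen U → IsOpen V → IsOpen (λ y → U y × V y)
    union : (J : Set₁) (U : J → Pred X (Level.suc 0ℓ)) →
            (∀ j → IsOpen (U j)) → IsOpen (λ y → Σ J (λ j → U j y))
    ext   : ∀ {U V} → IsOpen U → U ≐ V → IsOpen V

  IsClosed : Pred X (Level.suc 0ℓ) → Set₂
  IsClosed C = IsOpen (∁ C)

  closure : Pred X 0ℓ → Pred X (Level.suc (Level.suc 0ℓ))
  closure A y = ∀ (C : Pred X (Level.suc 0ℓ)) → IsClosed C → (∀ {x} → A x → C x) → C y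

{-# OPTIONS --safe #-}
module Submission where

-- An open set of τ_d contains, around each of its points y, a ball B(y, ε) with
-- ε ≪ I: for a basic ball B(x, δ) ∋ y, interpolation and continuity of
-- u ⊗ − at I = ⨆ {e | e ≪ I} give e ≪ I with δ ≪ d(x,y) ⊗ e, and then
-- B(y, e) ⊆ B(x, δ) by the triangle inequality; finite intersections use the
-- join of two radii, which is still way below I.  So a point whose balls all
-- meet A lies in every closed superset of A; conversely, the complement of
-- B(y, δ) is closed.  Both directions use excluded middle.

open import Defs
open import Level using (0ℓ)
open import Data.Product using (∃; _×_; Σ; _,_; proj₁; proj₂)
open import Data.Sum using (_⊎_; inj₁; inj₂)
open import Data.Empty using (⊥)
open import Relation.Unary using (Pred; _≐_; _⊆_; ∁)
open import Relation.Binary.PropositionalEquality using (_≡_; refl; sym; trans; cong; subst)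
open import Axiom.ExcludedMiddle using (ExcludedMiddle)
open import Axiom.DoubleNegationElimination using (em⇒dne)

module WayBelow (Q : Quantale) where
  open Quantale Q

  ≡⇒⊑ : ∀ {x y} → x ≡ y → x ⊑ y
  ≡⇒⊑ refl = ⊑-refl

  ≪⇒⊑ : ∀ {x y} → x ≪ y → x ⊑ y
  ≪⇒⊑ {x} {y} x≪y with x≪y (_≡ y) singleton-directed (⨆-upper _ refl)
    where
    singleton-directed : Directed (_≡ y)
    singleton-directed = (y , refl) , λ a≡y b≡y → y , refl , ≡⇒⊑ a≡y , ≡⇒⊑ b≡y
  ... | _ , refl , x⊑y = x⊑y

  ⊑-≪-trans : ∀ {a b c} → a ⊑ b → b ≪ c → a ≪ c
  ⊑-≪-trans a⊑b b≪c D dir c⊑⨆D with b≪c D dir c⊑⨆D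
  ... | d , Dd , b⊑d = d , Dd , ⊑-trans a⊑b b⊑d

  ≪-⊑-trans : ∀ {a b c} → a ≪ b → b ⊑ c → a ≪ c
  ≪-⊑-trans a≪b b⊑c D dir c⊑⨆D = a≪b D dir (⊑-trans b⊑c c⊑⨆D)

  bottom : Carrier
  bottom = ⨆ (λ _ → ⊥)

  bottom-≪ : ∀ {x} → bottom ≪ x
  bottom-≪ D ((d , Dd) , _) _ = d , Dd , ⨆-least _ (λ ())

  infixl 6 _⊔_
  _⊔_ : Carrier → Carrier → Carrier
  a ⊔ b = ⨆ (λ z → z ≡ a ⊎ z ≡ b)

  x⊑x⊔y : ∀ {a b} → a ⊑ a ⊔ b
  x⊑x⊔y = ⨆-upper _ (inj₁ refl)

  y⊑x⊔y : ∀ {a b} → b ⊑ a ⊔ b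
  y⊑x⊔y = ⨆-upper _ (inj₂ refl)

  ⊔-least : ∀ {a b c} → a ⊑ c → b ⊑ c → a ⊔ b ⊑ c
  ⊔-least a⊑c b⊑c = ⨆-least _ λ { (inj₁ refl) → a⊑c ; (inj₂ refl) → b⊑c }

  ⊔-≪ : ∀ {a b x} → a ≪ x → b ≪ x → a ⊔ b ≪ x
  ⊔-≪ a≪x b≪x D dir x⊑⨆D with a≪x D dir x⊑⨆D | b≪x D dir x⊑⨆D
  ... | d₁ , Dd₁ , a⊑d₁ | d₂ , Dd₂ , b⊑d₂ with proj₂ dir Dd₁ Dd₂
  ... | c , Dc , d₁⊑c , d₂⊑c = c , Dc , ⊔-least (⊑-trans a⊑d₁ d₁⊑c) (⊑-trans b⊑d₂ d₂⊑c)

  ⊗-monoʳ-⊑ : ∀ u {s t} → s ⊑ t → u ⊗ s ⊑ u ⊗ t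
  ⊗-monoʳ-⊑ u {s} {t} s⊑t = ⊑-trans (⨆-upper _ (s , s⊑t , refl))
    (≡⇒⊑ (trans (sym (⊗-distribˡ-⨆ u (_⊑ t))) (cong (u ⊗_) ⨆-downset)))
    where
    ⨆-downset : ⨆ (_⊑ t) ≡ t
    ⨆-downset = ⊑-antisym (⨆-least _ (λ z⊑t → z⊑t)) (⨆-upper _ ⊑-refl)

module Continuous (Q : Quantale) (continuous : IsContinuous Q) where
  open Quantale Q
  open IsContinuous continuous
  open WayBelow Q

  approximants : Carrier → Pred Carrier 0ℓ
  approximants x = proj₁ (approx x)

  approximant⇒≪ : ∀ {x z} → approximants x z → z ≪ x
  approximant⇒≪ {x} {z} = proj₁ (proj₂ (approx x)) z

  ≪⇒approximant : ∀ {x z} → z ≪ x → approximants x z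
  ≪⇒approximant {x} {z} = proj₁ (proj₂ (proj₂ (approx x))) z

  ⨆-approximants : ∀ x → x ≡ ⨆ (approximants x)
  ⨆-approximants x = proj₂ (proj₂ (proj₂ (approx x)))

  approximants-⊔ : ∀ {x a b} → approximants x a → approximants x b → approximants x (a ⊔ b)
  approximants-⊔ a b = ≪⇒approximant (⊔-≪ (approximant⇒≪ a) (approximant⇒≪ b))

  approximants-bottom : ∀ {x} → approximants x bottom
  approximants-bottom = ≪⇒approximant bottom-≪

  approximants² : Carrier → Pred Carrier 0ℓ
  approximants² y a = Σ Carrier (λ z → approximants y z × approximants z a)

  approximants²-directed : ∀ y → Directed (approximants² y)
  approximants²-directed y =
    (bottom , bottom , approximants-bottom , approximants-bottom) ,
    λ { {a} {b} (z₁ , y≫z₁ , z₁≫a) (z₂ , y≫z₂ , z₂≫b) →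
          a ⊔ b
        , ( z₁ ⊔ z₂ , approximants-⊔ y≫z₁ y≫z₂
          , ≪⇒approximant (⊔-≪ (≪-⊑-trans (approximant⇒≪ z₁≫a) x⊑x⊔y)
                               (≪-⊑-trans (approximant⇒≪ z₂≫b) y⊑x⊔y)))
        , x⊑x⊔y , y⊑x⊔y }

  ⊑-⨆-approximants² : ∀ y → y ⊑ ⨆ (approximants² y)
  ⊑-⨆-approximants² y = ⊑-trans (≡⇒⊑ (⨆-approximants y)) (⨆-least _ λ {z} y≫z →
    ⊑-trans (≡⇒⊑ (⨆-approximants z)) (⨆-least _ λ z≫a → ⨆-upper _ (z , y≫z , z≫a)))

  ≪-interpolate : ∀ {x y} → x ≪ y → ∃ λ z → x ≪ z × z ≪ y
  ≪-interpolate {y = y} x≪y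
    with x≪y (approximants² y) (approximants²-directed y) (⊑-⨆-approximants² y)
  ... | _ , (z , y≫z , z≫a) , x⊑a = z , ⊑-≪-trans x⊑a (approximant⇒≪ z≫a) , approximant⇒≪ y≫z

  ⊗-approximants : Carrier → Carrier → Pred Carrier 0ℓ
  ⊗-approximants u x q = Σ Carrier (λ s → approximants x s × q ≡ u ⊗ s)

  ⊗-approximants-directed : ∀ u x → Directed (⊗-approximants u x)
  ⊗-approximants-directed u x =
    (u ⊗ bottom , bottom , approximants-bottom , refl) ,
    λ { (s₁ , x≫s₁ , refl) (s₂ , x≫s₂ , refl) →
          u ⊗ (s₁ ⊔ s₂) , (s₁ ⊔ s₂ , approximants-⊔ x≫s₁ x≫s₂ , refl)
        , ⊗-monoʳ-⊑ u x⊑x⊔y , ⊗-monoʳ-⊑ u y⊑x⊔y }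

  ⊗-⨆-approximants : ∀ u x → u ⊗ x ≡ ⨆ (⊗-approximants u x)
  ⊗-⨆-approximants u x = trans (cong (u ⊗_) (⨆-approximants x)) (⊗-distribˡ-⨆ u _)

  ≪-⊗-approximate : ∀ {δ u x} → δ ≪ u ⊗ x →
                    ∃ λ e → e ≪ x × (∀ {v} → e ⊑ v → δ ≪ u ⊗ v)
  ≪-⊗-approximate {δ} {u} {x} δ≪u⊗x with ≪-interpolate δ≪u⊗x
  ... | δ′ , δ≪δ′ , δ′≪u⊗x
    with δ′≪u⊗x (⊗-approximants u x) (⊗-approximants-directed u x)
                (≡⇒⊑ (⊗-⨆-approximants u x))
  ... | _ , (e , x≫e , refl) , δ′⊑u⊗e =
    e , approximant⇒≪ x≫e , λ e⊑v → ≪-⊑-trans δ≪δ′ (⊑-trans δ′⊑u⊗e (⊗-monoʳ-⊑ u e⊑v))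

module ClosureViaBalls (em : ExcludedMiddle (Level.suc 0ℓ))
                       (Q : Quantale) (continuous : IsContinuous Q) (M : QMetricSpace Q) where
  open Quantale Q
  open WayBelow Q
  open Continuous Q continuous
  open QMetricSpace M

  ball-⊆-ball : ∀ {x y δ} → B x δ y → ∃ λ ε → ε ≪ I × B y ε ⊆ B x δ
  ball-⊆-ball {x} {y} {δ} δ≪dxy
    with ≪-⊗-approximate (subst (δ ≪_) (sym (⊗-identityʳ (d x y))) δ≪dxy)
  ... | e , e≪I , δ≪dxy⊗_ = e , e≪I , λ {z} e≪dyz →
    ≪-⊑-trans (δ≪dxy⊗ (≪⇒⊑ e≪dyz)) (d-trans x y z)

  open⇒contains-ball : ∀ {U} → IsOpen U → ∀ {y} → U y → ∃ λ ε → ε ≪ I × B y ε ⊆ U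
  open⇒contains-ball (ball x δ _) y∈B = ball-⊆-ball y∈B
  open⇒contains-ball whole _ = bottom , bottom-≪ , λ _ → Level.lift _
  open⇒contains-ball (inter U-open V-open) (y∈U , y∈V)
    with open⇒contains-ball U-open y∈U | open⇒contains-ball V-open y∈V
  ... | ε₁ , ε₁≪I , B₁⊆U | ε₂ , ε₂≪I , B₂⊆V =
    ε₁ ⊔ ε₂ , ⊔-≪ ε₁≪I ε₂≪I ,
    λ ε≪d → B₁⊆U (⊑-≪-trans x⊑x⊔y ε≪d) , B₂⊆V (⊑-≪-trans y⊑x⊔y ε≪d)
  open⇒contains-ball (union J U U-open) (j , y∈Uj) with open⇒contains-ball (U-open j) y∈Uj
  ... | ε , ε≪I , B⊆Uj = ε , ε≪I , λ ε≪d → j , B⊆Uj ε≪d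
  open⇒contains-ball (ext U-open (U⊆V , V⊆U)) y∈V with open⇒contains-ball U-open (V⊆U y∈V)
  ... | ε , ε≪I , B⊆U = ε , ε≪I , λ ε≪d → U⊆V (B⊆U ε≪d)

  ∁-ball-closed : ∀ {y δ} → δ ≪ I → IsClosed (∁ (B y δ))
  ∁-ball-closed {y} {δ} δ≪I = ext (ball y δ δ≪I) ((λ y∈B y∉B → y∉B y∈B) , em⇒dne em)

  MeetsBalls : Pred X 0ℓ → Pred X (Level.suc 0ℓ)
  MeetsBalls A y = ∀ δ → δ ≪ I → ∃ λ x → A x × δ ≪ d y x

  closure⇒meets-balls : ∀ A {y} → closure A y → MeetsBalls A y
  closure⇒meets-balls A {y} y∈cl δ δ≪I = em⇒dne em λ no-point →
    y∈cl (∁ (B y δ)) (∁-ball-closed δ≪I) (λ {x} x∈A δ≪dyx → no-point (x , x∈A , δ≪dyx))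
         (≪-⊑-trans δ≪I (d-refl y))

  meets-balls⇒closure : ∀ A {y} → MeetsBalls A y → closure A y
  meets-balls⇒closure A {y} meets C C-closed A⊆C = em⇒dne em λ y∉C →
    let ε , ε≪I , B⊆∁C = open⇒contains-ball C-closed y∉C
        x , x∈A , ε≪dyx = meets ε ε≪I
    in B⊆∁C ε≪dyx (A⊆C x∈A)

lemma4 : ExcludedMiddle (Level.suc 0ℓ) →
         (Q : Quantale) → IsContinuous Q → (M : QMetricSpace Q) →
         (A : Pred (QMetricSpace.X M) 0ℓ) →
         QMetricSpace.closure M A
           ≐ (λ y → ∀ δ → Quantale._≪_ Q δ (Quantale.I Q) →
                ∃ λ x → A x × Quantale._≪_ Q δ (QMetricSpace.d M y x))
lemma4 em Q continuous M A = closure⇒meets-balls A , meets-balls⇒closure A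
  where open ClosureViaBalls em Q continuous M
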